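{- Let $M,N\in\mathcal{M}$. (i) If $M\equiv_{\mathbb{A}}N$ then $M\equiv^{ae}N$. (ii) If $M\equiv^{ae}N$ and $M\twoheadrightarrow_h\mathsf{x}_n$ (for some $n\in\mathbb{N}$), then $N\twoheadrightarrow_h\mathsf{x}_n$. (iii) Hence the equivalence relation $\simeq^{ae}$ on $\mathbb{A}$ is non-trivial (it does not equate all addresses). (iv) In particular, $\#\mathsf{K}\not\simeq^{ae}\#\mathsf{S}$.
   Context: Addressing machines. Fix a countable set $\mathbb{A}$ of addresses and a symbol $\varnothing\notin\mathbb{A}$; $\mathbb{A}_\varnothing=\mathbb{A}\cup\{\varnothing\}$. A tape is a finite list of elements of $\mathbb{A}$; $a::T$ has head $a$ and tail $T$, $T@T'$ is concatenation. A program is a finite list of instructions generated by $P::=\mathtt{Load}\ i;P\mid A$, $A::=\mathtt{App}(i,j,k);A\mid C$, $C::=\mathtt{Call}\ i\mid\varepsilon$ ($i,j,k\in\mathbb{N}$). For $r\in\mathbb{N}$, $I\subseteq\{0,\dots,r-1\}$, $I\models^r P$ is the least relation such that: $I\models^r\varepsilon$; $I\models^r\mathtt{Call}\ i$ if $i\in I$; $I\models^r\mathtt{App}(i,j,k);A$ if $i,j\in I$ and either ($k<r$ and $I\cup\{k\}\models^r A$) or ($k\ge r$ and $I\models^r A$); $I\models^r\mathtt{Load}\ i;P$ if either ($i<r$ and $I\cup\{i\}\models^r P$) or ($i\ge r$ and $I\models^r P$). An addressing machine is $M=\langle R_0,\dots,R_{r-1},P,T\rangle$ with registers in $\mathbb{A}_\varnothing$,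 $P$ valid w.r.t. the registers ($\{i<r\mid R_i\ne\varnothing\}\models^r P$), and a tape $T$; $\mathcal{M}$ is the set of all of them. $\vec R[R_i:=a]$ replaces $R_i$ by $a$ if $i<r$, is $\vec R$ if $i\ge r$. $M$ is stuck if $M.P=\mathtt{Load}\ i;P'$ and $M.T=[]$. Fix a bijection $\#:\mathcal{M}\to\mathbb{A}$ with inverse $\#^{ -1}$; $M@T'=\langle M.\vec R,M.P,M.T@T'\rangle$; $a\cdot b=\#(\#^{ -1}(a)@[b])$. Head reduction: $\langle\vec R,\mathtt{Load}\ i;P,a::T\rangle\to_h\langle\vec R[R_i:=a],P,T\rangle$, $\langle\vec R,\mathtt{App}(i,j,k);P,T\rangle\to_h\langle\vec R[R_k:=R_i\cdot R_j],P,T\rangle$, $\langle\vec R,\mathtt{Call}\ i,T\rangle\to_h\#^{ -1}(R_i)@T$; $\twoheadrightarrow_h$ reflexive-transitive closure; "$M\twoheadrightarrow_h\mathrm{stuck}$" means $M\twoheadrightarrow_h N$ for some stuck $N$. Induced relations: for a relation $\equiv_R$ on $\mathcal{M}$, $a\simeq_R b$ iff $\#^{ -1}(a)\equiv_R\#^{ -1}(b)$; on $\mathbb{A}_\varnothing$, both $\varnothing$ or both addresses related; componentwise on tuples/tapes of equal length; $M=_R N$ iff $M.\vec R\simeq_R N.\vec R$, $M.P=N.P$, $M.T\simeq_R N.T$. $\equiv_{\mathbb{A}}$ is the least equivalence relation on $\mathcal{M}$ such that $M\twoheadrightarrow_h Z=_{\mathbb{A}}N$ implies $M\equiv_{\mathbb{A}}N$.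 Applicative equivalence $\equiv^{ae}$ is the least equivalence relation on $\mathcal{M}$ such that: (1) $M\twoheadrightarrow_h Z=^{ae}N$ implies $M\equiv^{ae}N$; (2) if $M\twoheadrightarrow_h\mathrm{stuck}$, $N\twoheadrightarrow_h\mathrm{stuck}$ and $M@[a]\equiv^{ae}N@[a]$ for all $a\in\mathbb{A}$, then $M\equiv^{ae}N$; $\simeq^{ae},=^{ae}$ are induced by $\equiv^{ae}$. Machines: for $n\in\mathbb{N}$, $\mathsf{x}_n=\langle\varnothing,\dots,\varnothing,\varepsilon,[]\rangle$ with $n+1$ registers; $\mathsf{K}=\langle\varnothing,\mathtt{Load}\ 0;\mathtt{Load}\ 1;\mathtt{Call}\ 0,[]\rangle$ (one register); $\mathsf{S}=\langle\varnothing,\varnothing,\varnothing,\mathtt{Load}\ 0;\mathtt{Load}\ 1;\mathtt{Load}\ 2;\mathtt{App}(0,2,0);\mathtt{App}(1,2,1);\mathtt{App}(0,1,2);\mathtt{Call}\ 2,[]\rangle$ (three registers). -}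

module Defs where

open import Data.Nat using (ℕ; zero; suc; _<ᵇ_; _≡ᵇ_)
open import Data.Bool using (Bool; true; false; _∧_; _∨_; if_then_else_; T)
open import Data.Maybe using (Maybe; just; nothing; is-just)
open import Data.List using (List; []; _∷_; _++_; [_])
open import Data.Vec using (Vec; []; _∷_; replicate)
open import Data.Unit using (tt)
open import Data.Product using (Σ; _×_; _,_)
open import Function.Bundles using (_↔_; Inverse)
open import Relation.Binary.PropositionalEquality using (_≡_)
open import Relation.Binary.Construct.Closure.ReflexiveTransitive using (Star)
import Data.Vec.Relation.Binary.Pointwise.Inductive as VP
import Data.List.Relation.Binary.Pointwise as LP

-- Programs, following the grammar
--   P ::= Load i; P | A      A ::= App(i,j,k); A | C      C ::= Call i | ε

data Cont : Set where
  call : ℕ → Cont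
  ε    : Cont

data Apps : Set where
  app  : ℕ → ℕ → ℕ → Apps → Apps
  cont : Cont → Apps

data Prog : Set where
  load : ℕ → Prog → Prog
  apps : Apps → Prog

-- Validity  I ⊨^r P.  A set I ⊆ ℕ is represented by its characteristic
-- function ℕ → Bool.  The relation is syntax directed, so the least
-- relation is computed by the following recursion.

insert : ℕ → (ℕ → Bool) → (ℕ → Bool)
insert k I j = (j ≡ᵇ k) ∨ I j

validC : (ℕ → Bool) → Cont → Bool
validC I (call i) = I i
validC I ε        = true

validA : ℕ → (ℕ → Bool) → Apps → Bool
validA r I (app i j k A) =
  I i ∧ I j ∧ validA r (if k <ᵇ r then insert k I else I) A
validA r I (cont C) = validC I C

validP : ℕ → (ℕ → Bool) → Prog → Bool
validP r I (load i P) = validP r (if i <ᵇ r then insert i I else I) P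
validP r I (apps A)   = validA r I A

-- Registers: a vector of length r over A_∅ = Maybe A (nothing = ∅).

module _ {A : Set} where

  -- R_i (nothing if i ≥ r)
  lkp : ∀ {r} → Vec (Maybe A) r → ℕ → Maybe A
  lkp []       i       = nothing
  lkp (x ∷ xs) zero    = x
  lkp (x ∷ xs) (suc i) = lkp xs i

  -- R[R_i := a] (unchanged if i ≥ r)
  upd : ∀ {r} → Vec (Maybe A) r → ℕ → Maybe A → Vec (Maybe A) r
  upd []       i       a = []
  upd (x ∷ xs) zero    a = a ∷ xs
  upd (x ∷ xs) (suc i) a = x ∷ upd xs i a

  filled : ∀ {r} → Vec (Maybe A) r → (ℕ → Bool)
  filled R i = is-just (lkp R i)

record Machine (A : Set) : Set where
  constructor mk
  field
    r     : ℕ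
    R     : Vec (Maybe A) r
    P     : Prog
    valid : T (validP r (filled R) P)
    tape  : List A
open Machine public

module Semantics (A : Set) (enc : Machine A ↔ A) where

  # : Machine A → A
  # = Inverse.to enc

  #⁻¹ : A → Machine A
  #⁻¹ = Inverse.from enc

  _⊕_ : Machine A → List A → Machine A
  mk r R P v T ⊕ T' = mk r R P v (T ++ T')

  _·_ : A → A → A
  a · b = # (#⁻¹ a ⊕ [ b ])

  data _→h_ : Machine A → Machine A → Set where
    loadStep : ∀ {r R i P a T v v'} →
      mk r R (load i P) v (a ∷ T) →h mk r (upd R i (just a)) P v' T
    appStep : ∀ {r R i j k Ap a b T v v'} →
      lkp R i ≡ just a → lkp R j ≡ just b →
      mk r R (apps (app i j k Ap)) v T →h mk r (upd R k (just (a · b))) (apps Ap) v' T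
    callStep : ∀ {r R i a T v} →
      lkp R i ≡ just a →
      mk r R (apps (cont (call i))) v T →h (#⁻¹ a ⊕ T)

  _↠h_ : Machine A → Machine A → Set
  _↠h_ = Star _→h_

  Stuck : Machine A → Set
  Stuck M = Σ ℕ λ i → Σ Prog λ P' → (P M ≡ load i P') × (tape M ≡ [])

  _↠stuck : Machine A → Set
  M ↠stuck = Σ (Machine A) λ N → (M ↠h N) × Stuck N

  module Induced (E : Machine A → Machine A → Set) where

    _≃_ : A → A → Set
    a ≃ b = E (#⁻¹ a) (#⁻¹ b)

    data _≃∅_ : Maybe A → Maybe A → Set where
      both∅ : nothing ≃∅ nothing
      bothA : ∀ {a b} → a ≃ b → just a ≃∅ just b

    data _=M_ : Machine A → Machine A → Set where
      eqM : ∀ {r R R' P T T' v v'} →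
        VP.Pointwise _≃∅_ R R' → LP.Pointwise _≃_ T T' →
        mk r R P v T =M mk r R' P v' T'

  data _≡A_ : Machine A → Machine A → Set where
    reflA  : ∀ {M} → M ≡A M
    symA   : ∀ {M N} → M ≡A N → N ≡A M
    transA : ∀ {M N L} → M ≡A N → N ≡A L → M ≡A L
    redA   : ∀ {M Z N} → M ↠h Z → Induced._=M_ _≡A_ Z N → M ≡A N

  data _≡ae_ : Machine A → Machine A → Set where
    reflae  : ∀ {M} → M ≡ae M
    symae   : ∀ {M N} → M ≡ae N → N ≡ae M
    transae : ∀ {M N L} → M ≡ae N → N ≡ae L → M ≡ae L
    redae   : ∀ {M Z N} → M ↠h Z → Induced._=M_ _≡ae_ Z N → M ≡ae N
    extae   : ∀ {M N} → M ↠stuck → N ↠stuck →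
              (∀ a → (M ⊕ [ a ]) ≡ae (N ⊕ [ a ])) → M ≡ae N

  _≃ae_ : A → A → Set
  _≃ae_ = Induced._≃_ _≡ae_

module _ {A : Set} where

  x : ℕ → Machine A
  x n = mk (suc n) (replicate (suc n) nothing) (apps (cont ε)) tt []

  K : Machine A
  K = mk 1 (nothing ∷ []) (load 0 (load 1 (apps (cont (call 0))))) tt []

  S : Machine A
  S = mk 3 (nothing ∷ nothing ∷ nothing ∷ [])
        (load 0 (load 1 (load 2
          (apps (app 0 2 0 (app 1 2 1 (app 0 1 2 (cont (call 2)))))))))
        tt []

-- An applicative equivalence can be witnessed, as a least relation, only by
-- head reductions, pointwise comparisons of registers and tapes, and
-- extensionality at stuck machines; none of these can separate a machine that
-- halts in x n on some tape from one that does not.  So ≡ae is contained in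
-- the observational equivalence "M @ T ↠ x n iff N @ T ↠ x n for all n, T".
-- The only delicate rule is the pointwise one: it relates machines whose
-- registers hold merely observationally equivalent addresses, and these are
-- combined by application before being called.  One therefore simulates a
-- halting run of one machine by the other modulo the closure of observational
-- equivalence under application, unfolding a called address a · b into the
-- call of a on the tape b :: T.  Finally K a a ↠ x 0 for a = # x 0, whereas
-- S a a is stuck, so #K and #S are not applicatively equivalent.
module Submission where

open import Defs
open import Data.Nat using (ℕ; zero; suc; _<ᵇ_; _≡ᵇ_)
open import Data.Bool using (Bool; true; false; _∨_; _∧_; if_then_else_; T)
open import Data.Bool.Properties using (T-irrelevant)
open import Data.Maybe using (Maybe; just; nothing; is-just)
open import Data.List using (List; []; _∷_; _++_; [_])
open import Data.List.Properties using (++-assoc; ++-identityʳ)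
open import Data.Vec using (Vec; []; _∷_; replicate)
open import Data.Product using (_×_; _,_; -,_; proj₁; proj₂; ∃; ∃₂)
open import Data.Maybe.Properties using (just-injective)
open import Function using (id; _∘_)
open import Function.Bundles using (_↔_; Inverse)
open import Relation.Nullary using (¬_; contradiction)
open import Relation.Binary using (Rel)
open import Relation.Binary.Rewriting using (Deterministic; IsNormalForm; det⇒conf)
open import Relation.Binary.PropositionalEquality
  using (_≡_; _≗_; refl; sym; trans; cong; cong₂; subst; subst₂)
open import Relation.Binary.Construct.Closure.ReflexiveTransitive
  using (Star; ε; _◅_; _◅◅_; gmap)
import Data.Maybe.Relation.Binary.Pointwise as MP
import Data.Vec.Relation.Binary.Pointwise.Inductive as VP
import Data.List.Relation.Binary.Pointwise as LP

validC-cong : ∀ {I J} → I ≗ J → ∀ C → validC I C ≡ validC J C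
validC-cong I≗J (call i) = I≗J i
validC-cong I≗J ε        = refl

insertIf-cong : ∀ {I J} → I ≗ J → ∀ b k →
  (if b then insert k I else I) ≗ (if b then insert k J else J)
insertIf-cong I≗J true  k j = cong ((j ≡ᵇ k) ∨_) (I≗J j)
insertIf-cong I≗J false k j = I≗J j

validA-cong : ∀ r {I J} → I ≗ J → ∀ Ap → validA r I Ap ≡ validA r J Ap
validA-cong r I≗J (app i j k Ap) =
  cong₂ _∧_ (I≗J i) (cong₂ _∧_ (I≗J j) (validA-cong r (insertIf-cong I≗J (k <ᵇ r) k) Ap))
validA-cong r I≗J (cont C) = validC-cong I≗J C

validP-cong : ∀ r {I J} → I ≗ J → ∀ P → validP r I P ≡ validP r J P
validP-cong r I≗J (load i P) = validP-cong r (insertIf-cong I≗J (i <ᵇ r) i) P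
validP-cong r I≗J (apps Ap)  = validA-cong r I≗J Ap

module _ {a ℓ} {X : Set a} {_⟶_ : Rel X ℓ} (det : Deterministic _≡_ _⟶_) where

  ↠-normalForm : ∀ {u v w} → IsNormalForm _⟶_ w →
                 Star _⟶_ u v → Star _⟶_ u w → Star _⟶_ v w
  ↠-normalForm w-nf u↠v u↠w with det⇒conf det u↠v u↠w
  ... | _ , v↠w , ε     = v↠w
  ... | _ , _   , s ◅ _ = contradiction (-, s) w-nf

module Observation (A : Set) (enc : Machine A ↔ A) where
  open Semantics A enc

  #⁻¹∘# : ∀ M → #⁻¹ (# M) ≡ M
  #⁻¹∘# = Inverse.strictlyInverseʳ enc

  ⊕-assoc : ∀ M ts us → (M ⊕ ts) ⊕ us ≡ M ⊕ (ts ++ us)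
  ⊕-assoc M ts us = cong (mk (r M) (R M) (P M) (valid M)) (++-assoc (tape M) ts us)

  ⊕-identityʳ : ∀ M → M ⊕ [] ≡ M
  ⊕-identityʳ M = cong (mk (r M) (R M) (P M) (valid M)) (++-identityʳ (tape M))

  #⁻¹-· : ∀ a b ts → #⁻¹ (a · b) ⊕ ts ≡ #⁻¹ a ⊕ (b ∷ ts)
  #⁻¹-· a b ts = trans (cong (_⊕ ts) (#⁻¹∘# (#⁻¹ a ⊕ [ b ]))) (⊕-assoc (#⁻¹ a) [ b ] ts)

  →h-deterministic : Deterministic _≡_ _→h_
  →h-deterministic (loadStep {v' = v₁}) (loadStep {v' = v₂}) =
    cong (λ v → mk _ _ _ v _) (T-irrelevant v₁ v₂)
  →h-deterministic (appStep {v' = v₁} i₁ j₁) (appStep {v' = v₂} i₂ j₂)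
    with just-injective (trans (sym i₁) i₂) | just-injective (trans (sym j₁) j₂)
  ... | refl | refl = cong (λ v → mk _ _ _ v _) (T-irrelevant v₁ v₂)
  →h-deterministic (callStep i₁) (callStep i₂) with just-injective (trans (sym i₁) i₂)
  ... | refl = refl

  →h-⊕ : ∀ {M M'} us → M →h M' → (M ⊕ us) →h (M' ⊕ us)
  →h-⊕ us loadStep          = loadStep
  →h-⊕ us (appStep i j)     = appStep i j
  →h-⊕ us (callStep {a = a} {T = ts} i) =
    subst (_ →h_) (sym (⊕-assoc (#⁻¹ a) ts us)) (callStep i)

  ↠h-⊕ : ∀ {M M'} us → M ↠h M' → (M ⊕ us) ↠h (M' ⊕ us)
  ↠h-⊕ us = gmap (_⊕ us) (→h-⊕ us)

  _⇓_ : Machine A → ℕ → Set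
  M ⇓ n = M ↠h x n

  x-normalForm : ∀ n → IsNormalForm _→h_ (x n)
  x-normalForm n (_ , ())

  stuck-normalForm : ∀ {W} → Stuck W → IsNormalForm _→h_ W
  stuck-normalForm (_ , _ , refl , refl) (_ , ())

  ↠stuck⇒¬⇓ : ∀ {M n} → M ↠stuck → ¬ M ⇓ n
  ↠stuck⇒¬⇓ {n = n} (W , M↠W , W-stuck) M⇓n
    with ↠-normalForm →h-deterministic (x-normalForm n) M↠W M⇓n
  ... | ε     = case-x W-stuck
    where case-x : ¬ Stuck (x n)
          case-x (_ , _ , () , _)
  ... | s ◅ _ = stuck-normalForm W-stuck (-, s)

  _≲_ : Machine A → Machine A → Set
  M ≲ N = ∀ n ts → (M ⊕ ts) ⇓ n → (N ⊕ ts) ⇓ n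

  _≈_ : Machine A → Machine A → Set
  M ≈ N = M ≲ N × N ≲ M

  ≈-refl : ∀ {M} → M ≈ M
  ≈-refl = (λ _ _ → id) , (λ _ _ → id)

  ≈-sym : ∀ {M N} → M ≈ N → N ≈ M
  ≈-sym (M≲N , N≲M) = N≲M , M≲N

  ≈-trans : ∀ {L M N} → L ≈ M → M ≈ N → L ≈ N
  ≈-trans (L≲M , M≲L) (M≲N , N≲M) =
    (λ n ts → M≲N n ts ∘ L≲M n ts) , (λ n ts → M≲L n ts ∘ N≲M n ts)

  ≲-stuck : ∀ {M N} → M ↠stuck → (∀ a → (M ⊕ [ a ]) ≲ (N ⊕ [ a ])) → M ≲ N
  ≲-stuck {M} M-stuck _ n [] M⇓n =
    contradiction (subst (_⇓ n) (⊕-identityʳ M) M⇓n) (↠stuck⇒¬⇓ M-stuck)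
  ≲-stuck {M} {N} _ Ma≲Na n (a ∷ ts) =
    subst (_⇓ n) (⊕-assoc N [ a ] ts) ∘ Ma≲Na a n ts ∘ subst (_⇓ n) (sym (⊕-assoc M [ a ] ts))

  ≈-stuck : ∀ {M N} → M ↠stuck → N ↠stuck → (∀ a → (M ⊕ [ a ]) ≈ (N ⊕ [ a ])) → M ≈ N
  ≈-stuck M-stuck N-stuck Ma≈Na =
    ≲-stuck M-stuck (proj₁ ∘ Ma≈Na) , ≲-stuck N-stuck (proj₂ ∘ Ma≈Na)

  data _~_ : A → A → Set where
    obs  : ∀ {a b} → #⁻¹ a ≈ #⁻¹ b → a ~ b
    _·~_ : ∀ {a a' b b'} → a ~ a' → b ~ b' → (a · b) ~ (a' · b')

  ~-refl : ∀ {a} → a ~ a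
  ~-refl = obs ≈-refl

  ~-sym : ∀ {a b} → a ~ b → b ~ a
  ~-sym (obs a≈b) = obs (≈-sym a≈b)
  ~-sym (p ·~ q) = ~-sym p ·~ ~-sym q

  _~ᴿ_ : ∀ {m} → Vec (Maybe A) m → Vec (Maybe A) m → Set
  _~ᴿ_ = VP.Pointwise (MP.Pointwise _~_)

  _~ᵀ_ : List A → List A → Set
  _~ᵀ_ = LP.Pointwise _~_

  data _~ᴹ_ : Machine A → Machine A → Set where
    mk~ : ∀ {r R R' P ts ts' v v'} → R ~ᴿ R' → ts ~ᵀ ts' →
          mk r R P v ts ~ᴹ mk r R' P v' ts'

  ~ᴹ-sym : ∀ {M N} → M ~ᴹ N → N ~ᴹ M
  ~ᴹ-sym (mk~ Rs ts) = mk~ (VP.sym (MP.sym ~-sym) Rs) (LP.symmetric ~-sym ts)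

  ~ᴹ-⊕ : ∀ {M N} us → M ~ᴹ N → (M ⊕ us) ~ᴹ (N ⊕ us)
  ~ᴹ-⊕ us (mk~ Rs ts) = mk~ Rs (LP.++⁺ ts (LP.refl ~-refl))

  ⊕-~ᴹ : ∀ M {ts ts'} → ts ~ᵀ ts' → (M ⊕ ts) ~ᴹ (M ⊕ ts')
  ⊕-~ᴹ M ts = mk~ (VP.refl (MP.refl ~-refl)) (LP.++⁺ (LP.refl ~-refl) ts)

  lkp-~ : ∀ {m} {R R' : Vec (Maybe A) m} → R ~ᴿ R' → ∀ i →
          MP.Pointwise _~_ (lkp R i) (lkp R' i)
  lkp-~ VP.[]        i       = MP.nothing
  lkp-~ (u VP.∷ Rs) zero    = u
  lkp-~ (u VP.∷ Rs) (suc i) = lkp-~ Rs i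

  lkp-just-~ : ∀ {m} {R R' : Vec (Maybe A) m} {a} → R ~ᴿ R' → ∀ i →
               lkp R i ≡ just a → ∃ λ a' → lkp R' i ≡ just a' × a ~ a'
  lkp-just-~ Rs i Ri≡a = MP.just-inv (subst (λ u → MP.Pointwise _~_ u _) Ri≡a (lkp-~ Rs i))

  upd-~ : ∀ {m} {R R' : Vec (Maybe A) m} {u u'} → R ~ᴿ R' → ∀ i →
          MP.Pointwise _~_ u u' → upd R i u ~ᴿ upd R' i u'
  upd-~ VP.[]        i       u~u' = VP.[]
  upd-~ (_ VP.∷ Rs) zero    u~u' = u~u' VP.∷ Rs
  upd-~ (v VP.∷ Rs) (suc i) u~u' = v VP.∷ upd-~ Rs i u~u'

  valid-~ : ∀ {m} {R R' : Vec (Maybe A) m} → R ~ᴿ R' → ∀ P →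
            T (validP m (filled R) P) → T (validP m (filled R') P)
  valid-~ {m} Rs P = subst T (validP-cong m (λ j → is-just-~ (lkp-~ Rs j)) P)
    where is-just-~ : ∀ {u u'} → MP.Pointwise _~_ u u' → is-just u ≡ is-just u'
          is-just-~ (MP.just _) = refl
          is-just-~ MP.nothing  = refl

  empty-~ : ∀ {m} {R' : Vec (Maybe A) m} → replicate m nothing ~ᴿ R' → R' ≡ replicate m nothing
  empty-~ VP.[]                = refl
  empty-~ (MP.nothing VP.∷ Rs) = cong (nothing ∷_) (empty-~ Rs)

  x-~ᴹ : ∀ {n N} → x n ~ᴹ N → N ⇓ n
  x-~ᴹ {N = mk _ _ _ _ _} (mk~ Rs LP.[]) with empty-~ Rs
  ... | refl = ε

  -- The length index keeps the recursion of the simulation structural across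
  -- the transports along #⁻¹-·.
  data _↠⟨_⟩_ : Machine A → ℕ → Machine A → Set where
    ε   : ∀ {M} → M ↠⟨ 0 ⟩ M
    _◅_ : ∀ {L M N k} → L →h M → M ↠⟨ k ⟩ N → L ↠⟨ suc k ⟩ N

  counted : ∀ {M N} → M ↠h N → ∃ λ k → M ↠⟨ k ⟩ N
  counted ε       = -, ε
  counted (s ◅ d) = -, s ◅ proj₂ (counted d)

  simulate : ∀ {n k Z N} → Z ~ᴹ N → Z ↠⟨ k ⟩ x n → N ⇓ n
  simulate-call : ∀ {n k a a' ts ts'} → a ~ a' → ts ~ᵀ ts' →
                  (#⁻¹ a ⊕ ts) ↠⟨ k ⟩ x n → (#⁻¹ a' ⊕ ts') ⇓ n

  simulate Z~N ε = x-~ᴹ Z~N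
  simulate (mk~ Rs (t LP.∷ ts)) (loadStep {i = i} {P = P} {v' = v} ◅ run) =
    loadStep {v' = valid-~ Rs' P v} ◅ simulate (mk~ Rs' ts) run
    where Rs' = upd-~ Rs i (MP.just t)
  simulate (mk~ Rs ts) (appStep {i = i} {j} {k} {Ap} {v' = v} Ri Rj ◅ run)
    with lkp-just-~ Rs i Ri | lkp-just-~ Rs j Rj
  ... | _ , Ri' , a~a' | _ , Rj' , b~b' =
    appStep {v' = valid-~ Rs' (apps Ap) v} Ri' Rj' ◅ simulate (mk~ Rs' ts) run
    where Rs' = upd-~ Rs k (MP.just (a~a' ·~ b~b'))
  simulate (mk~ Rs ts) (callStep {i = i} Ri ◅ run) with lkp-just-~ Rs i Ri
  ... | _ , Ri' , a~a' = callStep Ri' ◅ simulate-call a~a' ts run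

  simulate-call {n} {ts' = ts'} (obs (a≲a' , _)) ts~ run =
    a≲a' n ts' (simulate (⊕-~ᴹ _ ts~) run)
  simulate-call {n} {ts = ts} {ts'} (_·~_ {a} {a'} {b} {b'} a~a' b~b') ts~ run =
    subst (_⇓ n) (sym (#⁻¹-· a' b' ts'))
      (simulate-call a~a' (b~b' LP.∷ ts~) (subst (_↠⟨ _ ⟩ x n) (#⁻¹-· a b ts) run))

  ~ᴹ⇒≲ : ∀ {M N} → M ~ᴹ N → M ≲ N
  ~ᴹ⇒≲ M~N n ts M⇓n = simulate (~ᴹ-⊕ ts M~N) (proj₂ (counted M⇓n))

  ≈-reduct : ∀ {M Z N} → M ↠h Z → Z ~ᴹ N → M ≈ N
  ≈-reduct M↠Z Z~N =
    (λ n ts M⇓n → ~ᴹ⇒≲ Z~N n ts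
        (↠-normalForm →h-deterministic (x-normalForm n) (↠h-⊕ ts M↠Z) M⇓n)) ,
    (λ n ts N⇓n → ↠h-⊕ ts M↠Z ◅◅ ~ᴹ⇒≲ (~ᴹ-sym Z~N) n ts N⇓n)

  module AE = Induced _≡ae_
  module AA = Induced _≡A_

  ≡ae⇒≈ : ∀ {M N} → M ≡ae N → M ≈ N
  ≃∅ae⇒~ᴿ : ∀ {m} {R R' : Vec (Maybe A) m} → VP.Pointwise AE._≃∅_ R R' → R ~ᴿ R'
  ≃ae⇒~ᵀ : ∀ {ts ts'} → LP.Pointwise _≃ae_ ts ts' → ts ~ᵀ ts'

  ≡ae⇒≈ reflae               = ≈-refl
  ≡ae⇒≈ (symae p)            = ≈-sym (≡ae⇒≈ p)
  ≡ae⇒≈ (transae p q)        = ≈-trans (≡ae⇒≈ p) (≡ae⇒≈ q)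
  ≡ae⇒≈ (redae M↠Z (AE.eqM Rs ts)) = ≈-reduct M↠Z (mk~ (≃∅ae⇒~ᴿ Rs) (≃ae⇒~ᵀ ts))
  ≡ae⇒≈ (extae M-stuck N-stuck Ma≡Na) = ≈-stuck M-stuck N-stuck (≡ae⇒≈ ∘ Ma≡Na)

  ≃∅ae⇒~ᴿ VP.[]                   = VP.[]
  ≃∅ae⇒~ᴿ (AE.both∅ VP.∷ Rs)      = MP.nothing VP.∷ ≃∅ae⇒~ᴿ Rs
  ≃∅ae⇒~ᴿ (AE.bothA a≃b VP.∷ Rs) = MP.just (obs (≡ae⇒≈ a≃b)) VP.∷ ≃∅ae⇒~ᴿ Rs

  ≃ae⇒~ᵀ LP.[]          = LP.[]
  ≃ae⇒~ᵀ (a≃b LP.∷ ts) = obs (≡ae⇒≈ a≃b) LP.∷ ≃ae⇒~ᵀ ts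

  ≡ae-⇓ : ∀ {M N n} → M ≡ae N → M ⇓ n → N ⇓ n
  ≡ae-⇓ {M} {N} {n} M≡N =
    subst (_⇓ n) (⊕-identityʳ N) ∘ proj₁ (≡ae⇒≈ M≡N) n [] ∘ subst (_⇓ n) (sym (⊕-identityʳ M))

  ≡A⇒≡ae : ∀ {M N} → M ≡A N → M ≡ae N
  ≃∅A⇒≃∅ae : ∀ {m} {R R' : Vec (Maybe A) m} →
             VP.Pointwise AA._≃∅_ R R' → VP.Pointwise AE._≃∅_ R R'
  ≃A⇒≃ae : ∀ {ts ts'} → LP.Pointwise AA._≃_ ts ts' → LP.Pointwise _≃ae_ ts ts'

  ≡A⇒≡ae reflA                     = reflae
  ≡A⇒≡ae (symA p)                  = symae (≡A⇒≡ae p)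
  ≡A⇒≡ae (transA p q)              = transae (≡A⇒≡ae p) (≡A⇒≡ae q)
  ≡A⇒≡ae (redA M↠Z (AA.eqM Rs ts)) = redae M↠Z (AE.eqM (≃∅A⇒≃∅ae Rs) (≃A⇒≃ae ts))

  ≃∅A⇒≃∅ae VP.[]                   = VP.[]
  ≃∅A⇒≃∅ae (AA.both∅ VP.∷ Rs)      = AE.both∅ VP.∷ ≃∅A⇒≃∅ae Rs
  ≃∅A⇒≃∅ae (AA.bothA a≃b VP.∷ Rs) = AE.bothA (≡A⇒≡ae a≃b) VP.∷ ≃∅A⇒≃∅ae Rs

  ≃A⇒≃ae LP.[]          = LP.[]
  ≃A⇒≃ae (a≃b LP.∷ ts) = ≡A⇒≡ae a≃b LP.∷ ≃A⇒≃ae ts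

  K-halts : (K ⊕ (# (x 0) ∷ # (x 0) ∷ [])) ⇓ 0
  K-halts = loadStep ◅ loadStep ◅ callStep refl ◅
    subst (_⇓ 0) (sym (trans (⊕-identityʳ _) (#⁻¹∘# (x 0)))) ε

  S-stuck : (S ⊕ (# (x 0) ∷ # (x 0) ∷ [])) ↠stuck
  S-stuck = -, (loadStep ◅ loadStep ◅ ε) , (2 , _ , refl , refl)

  K≄S : ¬ (# K ≃ae # S)
  K≄S K≃S = ↠stuck⇒¬⇓ S-stuck
    (subst₂ _≲_ (#⁻¹∘# K) (#⁻¹∘# S) (proj₁ (≡ae⇒≈ K≃S)) 0 _ K-halts)

lemma4p5 : (A : Set) → (countable : A ↔ ℕ) → (enc : Machine A ↔ A) →
    let open Semantics A enc in
      (∀ (M N : Machine A) → M ≡A N → M ≡ae N)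
      × (∀ (M N : Machine A) (n : ℕ) → M ≡ae N → M ↠h x n → N ↠h x n)
      × (∃₂ λ (a b : A) → ¬ (a ≃ae b))
      × (¬ (# K ≃ae # S))
lemma4p5 A _ enc =
  (λ _ _ → ≡A⇒≡ae) , (λ _ _ _ → ≡ae-⇓) , (# K , # S , K≄S) , K≄S
  where open Observation A enc
        open Semantics A enc using (#)
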